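{- Let $T$ be a semistandard tableau with entries in $\{1,\dots,n\}$, let $a_1\le\dots\le a_l$ be a weakly increasing sequence of integers in $\{1,\dots,n\}$ with weight $\alpha=(\alpha_1,\dots,\alpha_n)$ ($\alpha_m=\#\{s:a_s=m\}$), and let $T'=((T\leftarrow a_1)\leftarrow\cdots)\leftarrow a_l$. Let $\Lambda(i,j)=\sum_{r\ge j}T(i,r)$ and $\Lambda'(i,j)=\sum_{r\ge j}T'(i,r)$. Then $$\Lambda'(i,1)=\Lambda(i,1)+\alpha_1+\dots+\alpha_i,$$ and for $j\ge1$ $$\Lambda'(i,j+1)=\min\big(\Lambda(i,j)+\Lambda'(i-1,j+1),\ \Lambda(i,j+1)+\Lambda'(i-1,j)\big)-\Lambda(i-1,j).$$
   Context: For a tableau $X$, $X(i,r)$ denotes the number of entries $\le i$ (i.e. among $1,\dots,i$) in row $r$ of $X$ (so $X(0,r)=0$). $X\leftarrow a$ denotes Schensted row insertion of $a$ into $X$. Indices range over $i\ge1$, $j\ge1$. -}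

module Defs where

open import Data.Nat using (ℕ; zero; suc; _+_; _≤_; _<_; _<ᵇ_; _≤?_; _≟_)
open import Data.Bool using (if_then_else_)
open import Data.List using (List; []; _∷_; [_]; length; filter; map; drop; foldl)
open import Data.Nat.ListAction using (sum)
open import Data.List.Relation.Unary.All using (All)
open import Data.List.Relation.Unary.Linked using (Linked)
open import Data.Maybe using (Maybe; just; nothing)
open import Data.Product using (_×_; _,_)
open import Data.Unit using (⊤)
open import Data.Empty using (⊥)

-- A tableau is the list of its rows (top row first), each row a list of entries
-- read left to right.
Tableau : Set
Tableau = List (List ℕ)

StrictlyBelow : List ℕ → List ℕ → Set
StrictlyBelow _        []       = ⊤
StrictlyBelow []       (_ ∷ _)  = ⊥
StrictlyBelow (x ∷ xs) (y ∷ ys) = (x < y) × StrictlyBelow xs ys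

data NonEmpty : List ℕ → Set where
  nonempty : ∀ {x xs} → NonEmpty (x ∷ xs)

record Semistandard (n : ℕ) (T : Tableau) : Set where
  field
    rowsNonEmpty : All NonEmpty T
    rowsWeak     : All (Linked _≤_) T
    columns      : Linked StrictlyBelow T
    entries      : All (All (λ x → (1 ≤ x) × (x ≤ n))) T

insertRow : ℕ → List ℕ → Maybe ℕ × List ℕ
insertRow a [] = nothing , [ a ]
insertRow a (x ∷ xs) =
  if a <ᵇ x then (just x , a ∷ xs)
  else (let (b , ys) = insertRow a xs in (b , x ∷ ys))

insertT : Tableau → ℕ → Tableau
insertT [] a = [ a ] ∷ []
insertT (r ∷ rs) a with insertRow a r
... | nothing , r' = r' ∷ rs
... | just b  , r' = r' ∷ insertT rs b

insertAll : Tableau → List ℕ → Tableau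
insertAll = foldl insertT

countLe : ℕ → List ℕ → ℕ
countLe i row = length (filter (_≤? i) row)

-- Λ_X(i,j) = Σ_{r ≥ j} X(i,r)   (rows indexed from 1; j ≥ 1 intended)
Λ : Tableau → ℕ → ℕ → ℕ
Λ X i j = sum (map (countLe i) (drop (j Data.Nat.∸ 1) X))

weight : List ℕ → ℕ → ℕ
weight as m = length (filter (_≟ m) as)

weightSum : List ℕ → ℕ → ℕ
weightSum as zero    = 0
weightSum as (suc i) = weightSum as i + weight as (suc i)

-- Inserting the weakly increasing word as into T amounts to inserting it into the first row r,
-- which leaves a row r′ and bumps out a weakly increasing word bs, and then inserting bs into the
-- remaining rows.  Hence the recurrence at j ≥ 2, which only involves rows ≥ j - 1, is the one
-- for T without its first row, and everything reduces to the first row.  Insertion only permutes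
-- entries, which gives the first identity and countLe k r′ + countLe k bs = countLe k r + countLe k as.
-- For one row the recurrence becomes
--   countLe (p+1) bs + countLe p r = (countLe (p+1) r + countLe p bs) ⊓ (countLe p r + countLe p as):
-- the letters ≤ p come first and bump entries > p from left to right, so the number of bumped
-- entries equal to p+1 is the smaller of the number of (p+1)s in r and the number of letters ≤ p
-- that bump an entry > p.  This is proved letter by letter.
module Submission where

open import Defs
open import Data.Nat using (ℕ; zero; suc; _+_; _∸_; _≤_; _<_; _⊓_; _≤?_; _≟_; _<ᵇ_; z≤n; s≤s)
open import Data.Bool using (true; false; T)
open import Data.Nat.Properties
open import Data.Nat.Tactic.RingSolver using (solve-∀)
open import Data.List using (List; []; _∷_; [_]; _++_; length; filter; concat; fromMaybe)
open import Data.List.Properties using (length-++; filter-++; filter-accept; filter-reject; filter-none; length-filter; drop-[])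
open import Data.List.Relation.Unary.All as All using (All; []; _∷_)
open import Data.List.Relation.Unary.All.Properties using (++⁺; ++⁻)
open import Data.List.Relation.Unary.AllPairs using (AllPairs; []; _∷_)
open import Data.List.Relation.Unary.Linked using (Linked)
open import Data.List.Relation.Unary.Linked.Properties using (Linked⇒AllPairs)
open import Data.List.Relation.Binary.Permutation.Propositional
  using (_↭_; ↭-refl; ↭-prep; ↭-swap; ↭-sym; module PermutationReasoning)
open import Data.List.Relation.Binary.Permutation.Propositional.Properties
  using (↭-length; filter-↭; All-resp-↭; ++⁺ˡ; ++⁺ʳ; shift; shifts; ++-identityʳ)
open import Data.Maybe using (Maybe; just; nothing)
open import Data.Maybe.Relation.Unary.Any using (Any; just)
open import Data.Product using (_×_; _,_; proj₁; proj₂; ∃₂)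
open import Data.Sum using (_⊎_; inj₁; inj₂)
open import Relation.Binary.Definitions using (tri<; tri≈; tri>)
open import Relation.Binary.PropositionalEquality using (_≡_; _≢_; refl; sym; trans; cong; cong₂; subst; module ≡-Reasoning)
open import Relation.Nullary using (yes; no; contradiction)

Sorted : List ℕ → Set
Sorted = AllPairs _≤_

countLe-accept : ∀ {k x xs} → x ≤ k → countLe k (x ∷ xs) ≡ suc (countLe k xs)
countLe-accept {k} x≤k = cong length (filter-accept (_≤? k) x≤k)

countLe-reject : ∀ {k x xs} → k < x → countLe k (x ∷ xs) ≡ countLe k xs
countLe-reject {k} k<x = cong length (filter-reject (_≤? k) (<⇒≱ k<x))

countLe-++ : ∀ k xs ys → countLe k (xs ++ ys) ≡ countLe k xs + countLe k ys
countLe-++ k xs ys = trans (cong length (filter-++ (_≤? k) xs ys)) (length-++ (filter (_≤? k) xs))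

countLe-↭ : ∀ k {xs ys} → xs ↭ ys → countLe k xs ≡ countLe k ys
countLe-↭ k xs↭ys = ↭-length (filter-↭ (_≤? k) xs↭ys)

countLe-none : ∀ {k xs} → All (k <_) xs → countLe k xs ≡ 0
countLe-none {k} k<xs = cong length (filter-none (_≤? k) (All.map <⇒≱ k<xs))

countLe-mono : ∀ {j k} → j ≤ k → ∀ xs → countLe j xs ≤ countLe k xs
countLe-mono j≤k [] = z≤n
countLe-mono {j} {k} j≤k (x ∷ xs) with x ≤? j | x ≤? k
... | yes x≤j | _ rewrite countLe-accept {xs = xs} x≤j | countLe-accept {xs = xs} (≤-trans x≤j j≤k) =
  s≤s (countLe-mono j≤k xs)
... | no x≰j | yes x≤k rewrite countLe-reject {xs = xs} (≰⇒> x≰j) | countLe-accept {xs = xs} x≤k =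
  m≤n⇒m≤1+n (countLe-mono j≤k xs)
... | no x≰j | no x≰k rewrite countLe-reject {xs = xs} (≰⇒> x≰j) | countLe-reject {xs = xs} (≰⇒> x≰k) =
  countLe-mono j≤k xs

countLe-suc-gap : ∀ {p xs} → All (λ x → x ≤ p ⊎ suc p < x) xs → countLe (suc p) xs ≡ countLe p xs
countLe-suc-gap [] = refl
countLe-suc-gap {xs = x ∷ xs} (inj₁ x≤p ∷ gap)
  rewrite countLe-accept {xs = xs} (m≤n⇒m≤1+n x≤p) | countLe-accept {xs = xs} x≤p = cong suc (countLe-suc-gap gap)
countLe-suc-gap {p} {x ∷ xs} (inj₂ p+1<x ∷ gap)
  rewrite countLe-reject {xs = xs} p+1<x | countLe-reject {xs = xs} (<-trans (n<1+n p) p+1<x) = countLe-suc-gap gap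

data RowInsertion (a : ℕ) : List ℕ → Maybe ℕ → List ℕ → Set where
  append : RowInsertion a [] nothing [ a ]
  bump   : ∀ {x xs} → a < x → RowInsertion a (x ∷ xs) (just x) (a ∷ xs)
  skip   : ∀ {x xs mb ys} → x ≤ a → RowInsertion a xs mb ys → RowInsertion a (x ∷ xs) mb (x ∷ ys)

insertRow-RowInsertion : ∀ a r → RowInsertion a r (proj₁ (insertRow a r)) (proj₂ (insertRow a r))
insertRow-RowInsertion a [] = append
insertRow-RowInsertion a (x ∷ xs) with a <ᵇ x in a<ᵇx
... | true  = bump (<ᵇ⇒< a x (subst T (sym a<ᵇx) _))
... | false = skip (≮⇒≥ λ a<x → subst T a<ᵇx (<⇒<ᵇ a<x)) (insertRow-RowInsertion a xs)

RowInsertion-↭ : ∀ {a r mb r₁} → RowInsertion a r mb r₁ → fromMaybe mb ++ r₁ ↭ a ∷ r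
RowInsertion-↭ append = ↭-refl
RowInsertion-↭ (bump {x} _) = ↭-swap x _ ↭-refl
RowInsertion-↭ {a} {mb = mb} (skip {x} {xs} {ys = ys} _ ins) = begin
  fromMaybe mb ++ x ∷ ys  ↭⟨ shift x (fromMaybe mb) ys ⟩
  x ∷ fromMaybe mb ++ ys  ↭⟨ ↭-prep x (RowInsertion-↭ ins) ⟩
  x ∷ a ∷ xs              ↭⟨ ↭-swap x a ↭-refl ⟩
  a ∷ x ∷ xs              ∎
  where open PermutationReasoning

RowInsertion-All : ∀ {P : ℕ → Set} {a r mb r₁} → RowInsertion a r mb r₁ →
  P a → All P r → All P (fromMaybe mb) × All P r₁
RowInsertion-All {mb = mb} ins pa pr = ++⁻ (fromMaybe mb) (All-resp-↭ (↭-sym (RowInsertion-↭ ins)) (pa ∷ pr))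

RowInsertion-bump> : ∀ {a r mb r₁} → RowInsertion a r mb r₁ → All (a <_) (fromMaybe mb)
RowInsertion-bump> append = []
RowInsertion-bump> (bump a<x) = a<x ∷ []
RowInsertion-bump> (skip _ ins) = RowInsertion-bump> ins

RowInsertion-sorted : ∀ {a r mb r₁} → RowInsertion a r mb r₁ → Sorted r → Sorted r₁
RowInsertion-sorted append [] = [] ∷ []
RowInsertion-sorted (bump a<x) (x≤xs ∷ sxs) = All.map (≤-trans (<⇒≤ a<x)) x≤xs ∷ sxs
RowInsertion-sorted (skip x≤a ins) (x≤xs ∷ sxs) =
  proj₂ (RowInsertion-All ins x≤a x≤xs) ∷ RowInsertion-sorted ins sxs

RowInsertion-leftmost : ∀ {a r mb r₁} → RowInsertion a r mb r₁ → Sorted r →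
  All (λ x → x ≤ a ⊎ Any (_≤ x) mb) r
RowInsertion-leftmost append [] = []
RowInsertion-leftmost (bump a<x) (x≤xs ∷ _) = inj₂ (just ≤-refl) ∷ All.map (λ x≤y → inj₂ (just x≤y)) x≤xs
RowInsertion-leftmost (skip x≤a ins) (_ ∷ sxs) = inj₁ x≤a ∷ RowInsertion-leftmost ins sxs

data WordInsertion : List ℕ → List ℕ → List ℕ → List ℕ → Set where
  []  : ∀ {r} → WordInsertion r [] r []
  _∷_ : ∀ {a r mb r₁ as r′ bs} → RowInsertion a r mb r₁ → WordInsertion r₁ as r′ bs →
        WordInsertion r (a ∷ as) r′ (fromMaybe mb ++ bs)

insertAll-∷ : ∀ r rs as → ∃₂ λ r′ bs → WordInsertion r as r′ bs × insertAll (r ∷ rs) as ≡ r′ ∷ insertAll rs bs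
insertAll-∷ r rs [] = r , [] , [] , refl
insertAll-∷ r rs (a ∷ as) with insertRow a r | insertRow-RowInsertion a r
... | nothing , r₁ | ins = let r′ , bs , w , eq = insertAll-∷ r₁ rs as in r′ , bs , ins ∷ w , eq
... | just b  , r₁ | ins = let r′ , bs , w , eq = insertAll-∷ r₁ (insertT rs b) as in r′ , b ∷ bs , ins ∷ w , eq

WordInsertion-↭ : ∀ {r as r′ bs} → WordInsertion r as r′ bs → r′ ++ bs ↭ as ++ r
WordInsertion-↭ {r} [] = ++-identityʳ r
WordInsertion-↭ {r} (_∷_ {a} {mb = mb} {r₁} {as} {r′} {bs} ins w) = begin
  r′ ++ fromMaybe mb ++ bs   ↭⟨ shifts r′ (fromMaybe mb) ⟩
  fromMaybe mb ++ r′ ++ bs   ↭⟨ ++⁺ˡ (fromMaybe mb) (WordInsertion-↭ w) ⟩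
  fromMaybe mb ++ as ++ r₁   ↭⟨ shifts (fromMaybe mb) as ⟩
  as ++ fromMaybe mb ++ r₁   ↭⟨ ++⁺ˡ as (RowInsertion-↭ ins) ⟩
  as ++ a ∷ r                ↭⟨ shift a as r ⟩
  a ∷ as ++ r                ∎
  where open PermutationReasoning

countLe-suc-bump : ∀ {k a} mb → All (a <_) (fromMaybe mb) → countLe (suc k) (fromMaybe mb) ≤ countLe k [ a ]
countLe-suc-bump nothing [] = z≤n
countLe-suc-bump {k} {a} (just y) (a<y ∷ []) with a ≤? k
... | yes a≤k rewrite countLe-accept {xs = []} a≤k = length-filter (_≤? suc k) [ y ]
... | no a≰k rewrite countLe-reject {xs = []} (≤-<-trans (≰⇒> a≰k) a<y) = z≤n

countLe-bumped-≤ : ∀ k {r as r′ bs} → WordInsertion r as r′ bs → countLe (suc k) bs ≤ countLe k as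
countLe-bumped-≤ k [] = z≤n
countLe-bumped-≤ k (_∷_ {a} {mb = mb} {as = as} {bs = bs} ins w) = begin
  countLe (suc k) (fromMaybe mb ++ bs)             ≡⟨ countLe-++ (suc k) (fromMaybe mb) bs ⟩
  countLe (suc k) (fromMaybe mb) + countLe (suc k) bs
    ≤⟨ +-mono-≤ (countLe-suc-bump mb (RowInsertion-bump> ins)) (countLe-bumped-≤ k w) ⟩
  countLe k [ a ] + countLe k as                   ≡⟨ countLe-++ k [ a ] as ⟨
  countLe k (a ∷ as)                               ∎
  where open ≤-Reasoning

bumped-above : ∀ {a y r as r′ bs} → WordInsertion r as r′ bs →
  All (λ x → x ≤ a ⊎ y ≤ x) r → All (a ≤_) as → Sorted as → All (y ≤_) bs
bumped-above [] _ _ _ = []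
bumped-above {a} {y} (_∷_ {a′} {mb = mb} {r₁} ins w) split (a≤a′ ∷ _) (a′≤as ∷ sas) =
  ++⁺ (All.zipWith above (RowInsertion-bump> ins , bumps)) (bumped-above w split₁ a′≤as sas)
  where
    weaken : ∀ {x} → x ≤ a ⊎ y ≤ x → x ≤ a′ ⊎ y ≤ x
    weaken (inj₁ x≤a) = inj₁ (≤-trans x≤a a≤a′)
    weaken (inj₂ y≤x) = inj₂ y≤x
    above : ∀ {z} → a′ < z × (z ≤ a′ ⊎ y ≤ z) → y ≤ z
    above (a′<z , inj₁ z≤a′) = contradiction z≤a′ (<⇒≱ a′<z)
    above (_ , inj₂ y≤z) = y≤z
    bumps-split₁ : All (λ x → x ≤ a′ ⊎ y ≤ x) (fromMaybe mb) × All (λ x → x ≤ a′ ⊎ y ≤ x) r₁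
    bumps-split₁ = RowInsertion-All ins (inj₁ ≤-refl) (All.map weaken split)
    bumps : All (λ x → x ≤ a′ ⊎ y ≤ x) (fromMaybe mb)
    bumps = proj₁ bumps-split₁
    split₁ : All (λ x → x ≤ a′ ⊎ y ≤ x) r₁
    split₁ = proj₂ bumps-split₁

bumped-sorted : ∀ {r as r′ bs} → WordInsertion r as r′ bs → Sorted r → Sorted as → Sorted bs
bumped-sorted [] _ _ = []
bumped-sorted (_∷_ {mb = nothing} ins w) sr (_ ∷ sas) = bumped-sorted w (RowInsertion-sorted ins sr) sas
bumped-sorted (_∷_ {a} {r} {just y} ins w) sr (a≤as ∷ sas) =
  bumped-above w (proj₂ (RowInsertion-All ins (inj₁ ≤-refl) split)) a≤as sas
    ∷ bumped-sorted w (RowInsertion-sorted ins sr) sas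
  where
    unwrap : ∀ {x} → x ≤ a ⊎ Any (_≤ x) (just y) → x ≤ a ⊎ y ≤ x
    unwrap (inj₁ x≤a) = inj₁ x≤a
    unwrap (inj₂ (just y≤x)) = inj₂ y≤x
    split : All (λ x → x ≤ a ⊎ y ≤ x) r
    split = All.map unwrap (RowInsertion-leftmost ins sr)

RowRecurrence : ℕ → List ℕ → List ℕ → List ℕ → Set
RowRecurrence p r as bs =
  countLe (suc p) bs + countLe p r ≡ (countLe (suc p) r + countLe p bs) ⊓ (countLe p r + countLe p as)

RowRecurrence-noSmallLetters : ∀ p {r as r′ bs} → WordInsertion r as r′ bs → countLe p as ≡ 0 →
  RowRecurrence p r as bs
RowRecurrence-noSmallLetters p {r} {as} {bs = bs} w none = begin
  countLe (suc p) bs + v                   ≡⟨ cong (_+ v) suc≡0 ⟩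
  v                                        ≡⟨ m≥n⇒m⊓n≡n (countLe-mono (n≤1+n p) r) ⟨
  u ⊓ v                                    ≡⟨ cong₂ _⊓_ (+-identityʳ u) (+-identityʳ v) ⟨
  (u + 0) ⊓ (v + 0)                        ≡⟨ cong₂ (λ x y → (u + x) ⊓ (v + y)) ≡0 none ⟨
  (u + countLe p bs) ⊓ (v + countLe p as)  ∎
  where
    open ≡-Reasoning
    u v : ℕ
    u = countLe (suc p) r
    v = countLe p r
    suc≡0 : countLe (suc p) bs ≡ 0
    suc≡0 = n≤0⇒n≡0 (subst (countLe (suc p) bs ≤_) none (countLe-bumped-≤ p w))
    ≡0 : countLe p bs ≡ 0
    ≡0 = n≤0⇒n≡0 (subst (countLe p bs ≤_) suc≡0 (countLe-mono (n≤1+n p) bs))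

-- How one letter a ≤ p changes RowRecurrence, according to the entry it bumps: x′ and x count the
-- later bumped entries ≤ p+1 and ≤ p, y the later letters ≤ p, and u, v (u₁, v₁) the entries ≤ p+1
-- and ≤ p of the row before (after) inserting a.
step-bump≤p : ∀ {x′ x y u v u₁ v₁} → suc v₁ ≡ suc v → suc u₁ ≡ suc u →
  x′ + v₁ ≡ (u₁ + x) ⊓ (v₁ + y) → suc x′ + v ≡ (u + suc x) ⊓ (v + suc y)
step-bump≤p {x′} {x} {y} {u} {v} refl refl eq rewrite +-suc u x | +-suc v y = cong suc eq

step-bump≡p+1 : ∀ {x′ x y u v u₁ v₁} → v₁ ≡ suc v → suc u₁ ≡ suc u →
  x′ + v₁ ≡ (u₁ + x) ⊓ (v₁ + y) → suc x′ + v ≡ (u + x) ⊓ (v + suc y)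
step-bump≡p+1 {x′} {x} {y} {u} {v} refl refl eq rewrite +-suc v y = trans (sym (+-suc x′ v)) eq

step-bump>p+1 : ∀ {x′ x y u v u₁ v₁} → v₁ ≡ suc v → u₁ ≡ suc u → u ≡ v → x ≤ y →
  x′ + v₁ ≡ (u₁ + x) ⊓ (v₁ + y) → x′ + v ≡ (u + x) ⊓ (v + suc y)
step-bump>p+1 {x′} {x} {y} {v = v} refl refl refl x≤y eq
  rewrite m≤n⇒m⊓n≡m (+-monoʳ-≤ v (m≤n⇒m≤1+n x≤y)) | m≤n⇒m⊓n≡m (+-monoʳ-≤ (suc v) x≤y) =
  suc-injective (trans (sym (+-suc x′ v)) eq)

RowInsertion-countLe : ∀ {k a r mb r₁} → a ≤ k → RowInsertion a r mb r₁ →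
  countLe k (fromMaybe mb ++ r₁) ≡ suc (countLe k r)
RowInsertion-countLe a≤k ins = trans (countLe-↭ _ (RowInsertion-↭ ins)) (countLe-accept a≤k)

RowInsertion-gap : ∀ {p a r mb r₁} → a ≤ p → All (suc p <_) (fromMaybe mb) → RowInsertion a r mb r₁ →
  Sorted r → countLe (suc p) r ≡ countLe p r
RowInsertion-gap {p} {a} {mb = mb} a≤p p<mb ins sr =
  countLe-suc-gap (All.map side (RowInsertion-leftmost ins sr))
  where
    above-bump : ∀ {x} {mb′ : Maybe ℕ} → All (suc p <_) (fromMaybe mb′) → Any (_≤ x) mb′ → suc p < x
    above-bump (p<z ∷ []) (just z≤x) = <-≤-trans p<z z≤x
    side : ∀ {x} → x ≤ a ⊎ Any (_≤ x) mb → x ≤ p ⊎ suc p < x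
    side (inj₁ x≤a) = inj₁ (≤-trans x≤a a≤p)
    side (inj₂ z≤x) = inj₂ (above-bump p<mb z≤x)

RowRecurrence-step : ∀ {p a r mb r₁ as bs} → a ≤ p → RowInsertion a r mb r₁ → Sorted r →
  countLe p bs ≤ countLe p as → RowRecurrence p r₁ as bs → RowRecurrence p r (a ∷ as) (fromMaybe mb ++ bs)
RowRecurrence-step {p} {mb = nothing} {as = as} a≤p ins sr fewer rec
  rewrite countLe-accept {xs = as} a≤p =
  step-bump>p+1 (RowInsertion-countLe a≤p ins) (RowInsertion-countLe (m≤n⇒m≤1+n a≤p) ins)
                (RowInsertion-gap a≤p [] ins sr) fewer rec
RowRecurrence-step {p} {mb = just z} {r₁} {as} {bs} a≤p ins sr fewer rec
  rewrite countLe-accept {xs = as} a≤p with <-cmp z (suc p)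
... | tri< z<p+1 _ _
  rewrite countLe-accept {xs = bs} (<⇒≤ z<p+1) | countLe-accept {xs = bs} (m<1+n⇒m≤n z<p+1) =
  step-bump≤p (trans (sym (countLe-accept (m<1+n⇒m≤n z<p+1))) (RowInsertion-countLe a≤p ins))
              (trans (sym (countLe-accept (<⇒≤ z<p+1))) (RowInsertion-countLe (m≤n⇒m≤1+n a≤p) ins))
              rec
... | tri≈ _ refl _
  rewrite countLe-accept {xs = bs} (≤-refl {suc p}) | countLe-reject {xs = bs} (n<1+n p) =
  step-bump≡p+1 (trans (sym (countLe-reject (n<1+n p))) (RowInsertion-countLe a≤p ins))
                (trans (sym (countLe-accept {xs = r₁} (≤-refl {suc p}))) (RowInsertion-countLe (m≤n⇒m≤1+n a≤p) ins))
                rec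
... | tri> _ _ p+1<z
  rewrite countLe-reject {xs = bs} p+1<z | countLe-reject {xs = bs} (<-trans (n<1+n p) p+1<z) =
  step-bump>p+1 (trans (sym (countLe-reject (<-trans (n<1+n p) p+1<z))) (RowInsertion-countLe a≤p ins))
                (trans (sym (countLe-reject p+1<z)) (RowInsertion-countLe (m≤n⇒m≤1+n a≤p) ins))
                (RowInsertion-gap a≤p (p+1<z ∷ []) ins sr) fewer rec

RowRecurrence-bumped : ∀ p {r as r′ bs} → WordInsertion r as r′ bs → Sorted r → Sorted as → RowRecurrence p r as bs
RowRecurrence-bumped p {r} [] _ _ = RowRecurrence-noSmallLetters p {r} [] refl
RowRecurrence-bumped p w@(_∷_ {a} {as = as} {bs = bs} ins w′) sr (a≤as ∷ sas) with a ≤? p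
... | no a≰p = RowRecurrence-noSmallLetters p w (countLe-none (p<a ∷ All.map (<-≤-trans p<a) a≤as))
  where
    p<a : p < a
    p<a = ≰⇒> a≰p
... | yes a≤p = RowRecurrence-step a≤p ins sr bound (RowRecurrence-bumped p w′ (RowInsertion-sorted ins sr) sas)
  where
    bound : countLe p bs ≤ countLe p as
    bound = ≤-trans (countLe-mono (n≤1+n p) bs) (countLe-bumped-≤ p w′)

WordInsertion-countLe : ∀ k {r as r′ bs} → WordInsertion r as r′ bs →
  countLe k r′ + countLe k bs ≡ countLe k as + countLe k r
WordInsertion-countLe k {r} {as} {r′} {bs} w = begin
  countLe k r′ + countLe k bs  ≡⟨ countLe-++ k r′ bs ⟨
  countLe k (r′ ++ bs)         ≡⟨ countLe-↭ k (WordInsertion-↭ w) ⟩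
  countLe k (as ++ r)          ≡⟨ countLe-++ k as r ⟩
  countLe k as + countLe k r   ∎
  where open ≡-Reasoning

concat-insertT-↭ : ∀ X a → concat (insertT X a) ↭ a ∷ concat X
concat-insertT-↭ [] a = ↭-refl
concat-insertT-↭ (r ∷ rs) a with insertRow a r | insertRow-RowInsertion a r
... | nothing , r₁ | ins = ++⁺ʳ (concat rs) (RowInsertion-↭ ins)
... | just b  , r₁ | ins = begin
  r₁ ++ concat (insertT rs b)  ↭⟨ ++⁺ˡ r₁ (concat-insertT-↭ rs b) ⟩
  r₁ ++ b ∷ concat rs          ↭⟨ shift b r₁ (concat rs) ⟩
  b ∷ r₁ ++ concat rs          ↭⟨ ++⁺ʳ (concat rs) (RowInsertion-↭ ins) ⟩
  a ∷ r ++ concat rs           ∎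
  where open PermutationReasoning

concat-insertAll-↭ : ∀ X as → concat (insertAll X as) ↭ as ++ concat X
concat-insertAll-↭ X [] = ↭-refl
concat-insertAll-↭ X (a ∷ as) = begin
  concat (insertAll (insertT X a) as)  ↭⟨ concat-insertAll-↭ (insertT X a) as ⟩
  as ++ concat (insertT X a)           ↭⟨ ++⁺ˡ as (concat-insertT-↭ X a) ⟩
  as ++ a ∷ concat X                   ↭⟨ shift a as (concat X) ⟩
  a ∷ as ++ concat X                   ∎
  where open PermutationReasoning

Λ-concat : ∀ X k → Λ X k 1 ≡ countLe k (concat X)
Λ-concat [] k = refl
Λ-concat (r ∷ rs) k = trans (cong (countLe k r +_) (Λ-concat rs k)) (sym (countLe-++ k r (concat rs)))

Λ-insertAll : ∀ X as k → Λ (insertAll X as) k 1 ≡ Λ X k 1 + countLe k as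
Λ-insertAll X as k = begin
  Λ (insertAll X as) k 1               ≡⟨ Λ-concat (insertAll X as) k ⟩
  countLe k (concat (insertAll X as))  ≡⟨ countLe-↭ k (concat-insertAll-↭ X as) ⟩
  countLe k (as ++ concat X)           ≡⟨ countLe-++ k as (concat X) ⟩
  countLe k as + countLe k (concat X)  ≡⟨ +-comm (countLe k as) _ ⟩
  countLe k (concat X) + countLe k as  ≡⟨ cong (_+ countLe k as) (Λ-concat X k) ⟨
  Λ X k 1 + countLe k as               ∎
  where open ≡-Reasoning

Recurrence : Tableau → Tableau → ℕ → ℕ → Set
Recurrence T T′ i j =
  Λ T′ i (suc j) + Λ T (i ∸ 1) j ≡ (Λ T i j + Λ T′ (i ∸ 1) (suc j)) ⊓ (Λ T i (suc j) + Λ T′ (i ∸ 1) j)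

Recurrence-firstRow : ∀ p {r rs as r′ bs} → WordInsertion r as r′ bs → RowRecurrence p r as bs →
  Recurrence (r ∷ rs) (r′ ∷ insertAll rs bs) (suc p) 1
Recurrence-firstRow p {r} {rs} {as} {r′} {bs} w row =
  arith {U = Λ rs (suc p) 1} {Λ rs p 1} {u = countLe (suc p) r} {countLe p r} {countLe p r′}
    (Λ-insertAll rs bs (suc p)) (Λ-insertAll rs bs p) (WordInsertion-countLe p w) row
  where
    arith : ∀ {U′ V′ U V x′ x u v w y} → U′ ≡ U + x′ → V′ ≡ V + x → w + x ≡ y + v →
      x′ + v ≡ (u + x) ⊓ (v + y) → U′ + (v + V) ≡ ((u + U) + V′) ⊓ (U + (w + V′))
    arith {U = U} {V} {x′} {x} {u} {v} {w} {y} refl refl cons eq = begin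
      (U + x′) + (v + V)                         ≡⟨ swap-inner U x′ v V ⟩
      (U + V) + (x′ + v)                         ≡⟨ cong ((U + V) +_) eq ⟩
      (U + V) + ((u + x) ⊓ (v + y))              ≡⟨ +-distribˡ-⊓ (U + V) (u + x) (v + y) ⟩
      ((U + V) + (u + x)) ⊓ ((U + V) + (v + y))  ≡⟨ cong₂ _⊓_ (regroup₁ U V u x) (cong ((U + V) +_) cons′) ⟩
      ((u + U) + (V + x)) ⊓ ((U + V) + (w + x))  ≡⟨ cong (((u + U) + (V + x)) ⊓_) (regroup₂ U V w x) ⟩
      ((u + U) + (V + x)) ⊓ (U + (w + (V + x)))  ∎
      where
        open ≡-Reasoning
        cons′ : v + y ≡ w + x
        cons′ = trans (+-comm v y) (sym cons)
        swap-inner : ∀ a b c d → (a + b) + (c + d) ≡ (a + d) + (b + c)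
        swap-inner = solve-∀
        regroup₁ : ∀ a b c d → (a + b) + (c + d) ≡ (c + a) + (b + d)
        regroup₁ = solve-∀
        regroup₂ : ∀ a b c d → (a + b) + (c + d) ≡ a + (c + (b + d))
        regroup₂ = solve-∀

Λ-[]∷[] : ∀ i j → Λ ([] ∷ []) i j ≡ Λ [] i j
Λ-[]∷[] i j with j ∸ 1
... | zero  = refl
... | suc n = cong (λ X → Λ X i 1) (drop-[] n)

Recurrence-respˡ : ∀ {T₁ T₂ T′ i j} → (∀ i j → Λ T₁ i j ≡ Λ T₂ i j) → Recurrence T₁ T′ i j → Recurrence T₂ T′ i j
Recurrence-respˡ {i = i} {j} eq rec rewrite sym (eq i j) | sym (eq (i ∸ 1) j) | sym (eq i (suc j)) = rec

mutual
  Recurrence-insertAll : ∀ p j T as → All Sorted T → Sorted as → Recurrence T (insertAll T as) (suc p) (suc j)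
  Recurrence-insertAll p zero    [] [] _ _ = refl
  Recurrence-insertAll p (suc j) [] [] _ _ = refl
  -- A nonempty word inserted into [] or into [[]] gives the same tableau, and Λ ignores an empty row.
  Recurrence-insertAll p j [] (a ∷ as) _ sas =
    Recurrence-respˡ {T′ = insertAll [] (a ∷ as)} {suc p} {suc j} Λ-[]∷[]
      (Recurrence-insertAll-∷ p j [] [] (a ∷ as) [] [] sas)
  Recurrence-insertAll p j (r ∷ rs) as (sr ∷ srs) sas = Recurrence-insertAll-∷ p j r rs as sr srs sas

  Recurrence-insertAll-∷ : ∀ p j r rs as → Sorted r → All Sorted rs → Sorted as →
    Recurrence (r ∷ rs) (insertAll (r ∷ rs) as) (suc p) (suc j)
  Recurrence-insertAll-∷ p j r rs as sr srs sas with insertAll-∷ r rs as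
  ... | r′ , bs , w , eq = subst (λ T′ → Recurrence (r ∷ rs) T′ (suc p) (suc j)) (sym eq) (rows j)
    where
      rows : ∀ j → Recurrence (r ∷ rs) (r′ ∷ insertAll rs bs) (suc p) (suc j)
      -- Removing the first row shifts the row index: Λ (r ∷ rs) i (2 + j) reduces to Λ rs i (1 + j).
      rows zero    = Recurrence-firstRow p w (RowRecurrence-bumped p w sr sas)
      rows (suc j) = Recurrence-insertAll p j rs bs srs (bumped-sorted w sr sas)

weight-accept : ∀ {m xs} → weight (m ∷ xs) m ≡ suc (weight xs m)
weight-accept {m} = cong length (filter-accept (_≟ m) refl)

weight-reject : ∀ {m x xs} → x ≢ m → weight (x ∷ xs) m ≡ weight xs m
weight-reject {m} x≢m = cong length (filter-reject (_≟ m) x≢m)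

countLe-suc-weight : ∀ i xs → countLe (suc i) xs ≡ countLe i xs + weight xs (suc i)
countLe-suc-weight i [] = refl
countLe-suc-weight i (x ∷ xs) with <-cmp x (suc i)
... | tri< x<i+1 x≢i+1 _
  rewrite countLe-accept {xs = xs} (<⇒≤ x<i+1) | countLe-accept {xs = xs} (m<1+n⇒m≤n x<i+1) | weight-reject {xs = xs} x≢i+1 =
  cong suc (countLe-suc-weight i xs)
... | tri≈ _ refl _
  rewrite countLe-accept {xs = xs} (≤-refl {suc i}) | countLe-reject {xs = xs} (n<1+n i) | weight-accept {suc i} {xs} =
  trans (cong suc (countLe-suc-weight i xs)) (sym (+-suc _ _))
... | tri> _ x≢i+1 i+1<x
  rewrite countLe-reject {xs = xs} i+1<x | countLe-reject {xs = xs} (<-trans (n<1+n i) i+1<x) | weight-reject {xs = xs} x≢i+1 =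
  countLe-suc-weight i xs

weightSum-countLe : ∀ {as} → All (1 ≤_) as → ∀ i → weightSum as i ≡ countLe i as
weightSum-countLe positive zero    = sym (countLe-none positive)
weightSum-countLe {as} positive (suc i) =
  trans (cong (_+ weight as (suc i)) (weightSum-countLe positive i)) (sym (countLe-suc-weight i as))

lemma7p12 : (n : ℕ) (T : Tableau) (as : List ℕ) →
  Semistandard n T →
  Linked _≤_ as →
  All (λ a → (1 ≤ a) × (a ≤ n)) as →
  ((i : ℕ) → 1 ≤ i →
    Λ (insertAll T as) i 1 ≡ Λ T i 1 + weightSum as i)
  ×
  ((i j : ℕ) → 1 ≤ i → 1 ≤ j →
    Λ (insertAll T as) i (suc j) + Λ T (i ∸ 1) j
      ≡ (Λ T i j + Λ (insertAll T as) (i ∸ 1) (suc j))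
        ⊓ (Λ T i (suc j) + Λ (insertAll T as) (i ∸ 1) j))
lemma7p12 n T as ssyt as-weak as-range = all-rows , lower-rows
  where
    all-rows : ∀ i → 1 ≤ i → Λ (insertAll T as) i 1 ≡ Λ T i 1 + weightSum as i
    all-rows i _ = trans (Λ-insertAll T as i) (cong (Λ T i 1 +_) (sym (weightSum-countLe (All.map proj₁ as-range) i)))
    lower-rows : ∀ i j → 1 ≤ i → 1 ≤ j → Recurrence T (insertAll T as) i j
    lower-rows (suc p) (suc j) _ _ =
      Recurrence-insertAll p j T as (All.map (Linked⇒AllPairs ≤-trans) (Semistandard.rowsWeak ssyt))
        (Linked⇒AllPairs ≤-trans as-weak)
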